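{- Let $X$ be a set of permutations with $X=\mathrm{Sub}(\gamma_1)\oplus S_1=\mathrm{Sub}(\gamma_2)\oplus S_2$, where $\gamma_1,\gamma_2$ are finite permutations and $S_1,S_2$ are sum-complete closed sets. Then $S_1=S_2$.
   Context: A permutation of length $n$ is an arrangement of $1,\ldots,n$; order isomorphism means same relative order; $\alpha\preceq\beta$ means $\alpha$ is order isomorphic to a subsequence of $\beta$. A closed set is a set of finite permutations closed downward under $\preceq$. $\mathrm{Sub}(\gamma)$ for a finite permutation $\gamma$ is the set of permutations $\preceq\gamma$. For permutations $\alpha$ (of length $m$) and $\beta$, $\alpha\oplus\beta$ is $\alpha$ followed by $\beta$ with entries increased by $m$; $X\oplus Y=\{\sigma\oplus\tau:\sigma\in X,\tau\in Y\}$. A set $S$ is sum-complete if $\alpha\oplus\beta\in S$ for all $\alpha,\beta\in S$. -}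

module Defs where

open import Data.Nat using (ℕ; suc; _+_; _<_)
open import Data.List using (List; length; map; upTo; lookup; _++_)
open import Data.List.Relation.Binary.Permutation.Propositional using (_↭_)
open import Data.List.Relation.Binary.Sublist.Propositional using (_⊆_)
open import Data.Fin using (Fin; cast)
open import Data.Product using (Σ; ∃; _×_; _,_; proj₁)
open import Relation.Binary.PropositionalEquality using (_≡_)
open import Function.Bundles using (_⇔_)

IsPerm : List ℕ → Set
IsPerm l = l ↭ map suc (upTo (length l))

Perm : Set
Perm = Σ (List ℕ) IsPerm

OrderIso : List ℕ → List ℕ → Set
OrderIso a b = Σ (length a ≡ length b) λ eq →
  (i j : Fin (length a)) →
    (lookup a i < lookup a j) ⇔ (lookup b (cast eq i) < lookup b (cast eq j))

_≼_ : Perm → Perm → Set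
α ≼ β = ∃ λ (s : List ℕ) → (s ⊆ proj₁ β) × OrderIso (proj₁ α) s

PermSet : Set₁
PermSet = Perm → Set

_≐_ : PermSet → PermSet → Set
X ≐ Y = (σ : Perm) → (X σ → Y σ) × (Y σ → X σ)

Closed : PermSet → Set
Closed X = (α β : Perm) → α ≼ β → X β → X α

Sub : Perm → PermSet
Sub γ α = α ≼ γ

_⊕ˡ_ : List ℕ → List ℕ → List ℕ
a ⊕ˡ b = a ++ map (λ x → length a + x) b

-- Sum of two permutations; the result is a permutation (its list is a ⊕ˡ b).
-- To avoid needing the proof here, membership in X ⊕ Y is stated on the raw lists.
_⊕_ : PermSet → PermSet → PermSet
(X ⊕ Y) π = ∃ λ (σ : Perm) → ∃ λ (τ : Perm) →
  X σ × Y τ × (proj₁ π ≡ proj₁ σ ⊕ˡ proj₁ τ)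

SumComplete : PermSet → Set
SumComplete S = (α β : Perm) → S α → S β →
  (π : Perm) → proj₁ π ≡ proj₁ α ⊕ˡ proj₁ β → S π

-- Given σ ∈ S₁, sum-completeness puts γ₁ ⊕ σ ⊕ ⋯ ⊕ σ (with |γ₂| + 1 copies of σ) in
-- Sub γ₁ ⊕ S₁ = Sub γ₂ ⊕ S₂, so it splits as ρ ⊕ τ with ρ ≼ γ₂ and τ ∈ S₂. As |ρ| ≤ |γ₂|
-- is at most the number of copies of σ before the last one, the last copy lies inside τ;
-- hence σ ≼ τ and σ ∈ S₂ by closure.
module Submission where

open import Defs
open import Data.Nat using (ℕ; zero; suc; _+_; _*_; _<_; _≤_; s≤s)
open import Data.Nat.Properties
open import Data.List using (List; []; _∷_; length; map; upTo; applyUpTo; _++_)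
open import Data.List.Properties
  using (∷-injectiveʳ; length-map; length-++; length-upTo; map-++; map-∘; map-cong; map-upTo; ++-assoc)
open import Data.List.Relation.Binary.Permutation.Propositional using (_↭_; ↭-refl)
open import Data.List.Relation.Binary.Permutation.Propositional.Properties
  using (↭-length; ++⁺; map⁺)
open import Data.List.Relation.Binary.Sublist.Propositional using (_⊆_; ⊆-refl; minimum; _∷ʳ_)
open import Data.List.Relation.Binary.Sublist.Heterogeneous.Properties using (length-mono-≤)
open import Data.List.Relation.Binary.Pointwise
  using (Pointwise; Pointwise-length; lookup⁺; ≡⇒Pointwise-≡)
open import Data.List.Relation.Binary.Suffix.Heterogeneous using (Suffix; here; there; _++ˢ_)
import Data.List.Relation.Binary.Suffix.Heterogeneous.Properties as Suffix
open import Data.Product using (∃; _×_; _,_; proj₁; proj₂)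
open import Relation.Binary.PropositionalEquality
open import Function.Base using (_∘_)
open import Function.Bundles using (_⇔_; mk⇔)
open import Function.Properties.Equivalence using () renaming (refl to ⇔-refl)

private
  variable
    A B : Set
    a b r s t : List ℕ

applyUpTo-+ : (f : ℕ → A) (m n : ℕ) →
  applyUpTo f (m + n) ≡ applyUpTo f m ++ applyUpTo (λ x → f (m + x)) n
applyUpTo-+ f zero    n = refl
applyUpTo-+ f (suc m) n = cong (f 0 ∷_) (applyUpTo-+ (λ x → f (suc x)) m n)

upTo-+ : (m n : ℕ) → upTo (m + n) ≡ upTo m ++ map (m +_) (upTo n)
upTo-+ m n = begin
  upTo (m + n)                              ≡⟨ applyUpTo-+ (λ x → x) m n ⟩
  upTo m ++ applyUpTo (m +_) n              ≡⟨ cong (upTo m ++_) (map-upTo (m +_) n) ⟨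
  upTo m ++ map (m +_) (upTo n)             ∎
  where open ≡-Reasoning

++-suffix : (r {m} a {n} : List A) → r ++ m ≡ a ++ n → length r ≤ length a →
            Suffix _≡_ n m
++-suffix []      a refl _ = a ++ˢ Suffix.fromPointwise (≡⇒Pointwise-≡ refl)
++-suffix (x ∷ r) (y ∷ a) eq (s≤s r≤a) = ++-suffix r a (∷-injectiveʳ eq) r≤a

Suffix⇒⊆-Pointwise : {R : A → B → Set} {xs : List A} {ys : List B} → Suffix R xs ys →
                     ∃ λ zs → zs ⊆ ys × Pointwise R xs zs
Suffix⇒⊆-Pointwise {ys = ys} (here xs∼ys) = ys , ⊆-refl , xs∼ys
Suffix⇒⊆-Pointwise (there {y} xs≤ys) with zs , zs⊆ys , xs∼zs ← Suffix⇒⊆-Pointwise xs≤ys =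
  zs , y ∷ʳ zs⊆ys , xs∼zs

Pointwise⇒OrderIso : {R : ℕ → ℕ → Set} →
  (∀ {x y x′ y′} → R x y → R x′ y′ → x < x′ ⇔ y < y′) →
  Pointwise R a b → OrderIso a b
Pointwise⇒OrderIso R-reflects a∼b =
  Pointwise-length a∼b , λ i j → R-reflects (lookup⁺ a∼b i) (lookup⁺ a∼b j)

OrderIso-refl : (a : List ℕ) → OrderIso a a
OrderIso-refl a =
  Pointwise⇒OrderIso (λ { refl refl → ⇔-refl }) (≡⇒Pointwise-≡ {x = a} refl)

translation-⇔ : ∀ c d {x y x′ y′} → c + x ≡ d + y → c + x′ ≡ d + y′ → x < x′ ⇔ y < y′
translation-⇔ c d {x} {y} {x′} {y′} e e′ = mk⇔
  (λ x<x′ → +-cancelˡ-< d y y′ (subst₂ _<_ e e′ (+-monoʳ-< c x<x′)))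
  (λ y<y′ → +-cancelˡ-< c x x′ (subst₂ _<_ (sym e) (sym e′) (+-monoʳ-< d y<y′)))

length-⊕ˡ : (a b : List ℕ) → length (a ⊕ˡ b) ≡ length a + length b
length-⊕ˡ a b = trans (length-++ a) (cong (length a +_) (length-map _ b))

⊕ˡ-assoc : (a b c : List ℕ) → (a ⊕ˡ b) ⊕ˡ c ≡ a ⊕ˡ (b ⊕ˡ c)
⊕ˡ-assoc a b c = begin
  (a ++ map (length a +_) b) ++ map (length (a ⊕ˡ b) +_) c
    ≡⟨ ++-assoc a _ _ ⟩
  a ++ (map (length a +_) b ++ map (length (a ⊕ˡ b) +_) c)
    ≡⟨ cong (λ c′ → a ++ (map (length a +_) b ++ c′)) shift-twice ⟩
  a ++ (map (length a +_) b ++ map (length a +_) (map (length b +_) c))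
    ≡⟨ cong (a ++_) (map-++ (length a +_) b _) ⟨
  a ⊕ˡ (b ⊕ˡ c) ∎
  where
  open ≡-Reasoning
  shift-twice : map (length (a ⊕ˡ b) +_) c ≡ map (length a +_) (map (length b +_) c)
  shift-twice = trans
    (map-cong (λ x → trans (cong (_+ x) (length-⊕ˡ a b)) (+-assoc (length a) (length b) x)) c)
    (map-∘ c)

⊕ˡ-rightSummand-embeds : a ⊕ˡ s ≡ r ⊕ˡ t → length r ≤ length a →
  ∃ λ u → u ⊆ t × OrderIso s u
⊕ˡ-rightSummand-embeds {a} {s} {r} {t} eq r≤a
  with u , u⊆t , s∼u ← Suffix⇒⊆-Pointwise
         (Suffix.map⁻ (length a +_) (length r +_) (++-suffix r a (sym eq) r≤a)) =
  u , u⊆t , Pointwise⇒OrderIso (translation-⇔ (length a) (length r)) s∼u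

ascending : ℕ → List ℕ
ascending n = map suc (upTo n)

ascending-⊕ˡ : (m n : ℕ) → ascending m ⊕ˡ ascending n ≡ ascending (m + n)
ascending-⊕ˡ m n = begin
  ascending m ++ map (length (ascending m) +_) (ascending n)
    ≡⟨ cong (λ k → ascending m ++ map (k +_) (ascending n))
            (trans (length-map suc (upTo m)) (length-upTo m)) ⟩
  ascending m ++ map (m +_) (map suc (upTo n))
    ≡⟨ cong (ascending m ++_) suc-commutes ⟩
  ascending m ++ map suc (map (m +_) (upTo n))
    ≡⟨ map-++ suc (upTo m) _ ⟨
  map suc (upTo m ++ map (m +_) (upTo n))
    ≡⟨ cong (map suc) (upTo-+ m n) ⟨
  ascending (m + n) ∎
  where
  open ≡-Reasoning
  suc-commutes : map (m +_) (map suc (upTo n)) ≡ map suc (map (m +_) (upTo n))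
  suc-commutes =
    trans (sym (map-∘ (upTo n))) (trans (map-cong (+-suc m) (upTo n)) (map-∘ (upTo n)))

⊕ˡ-↭ : ∀ {a′ b′} → a ↭ a′ → b ↭ b′ → a ⊕ˡ b ↭ a′ ⊕ˡ b′
⊕ˡ-↭ {a} {b} {a′} {b′} a↭a′ b↭b′ = ++⁺ a↭a′
  (subst (λ k → map (length a +_) b ↭ map (k +_) b′) (↭-length a↭a′) (map⁺ (length a +_) b↭b′))

_⊕ᵖ_ : Perm → Perm → Perm
(a , a↭) ⊕ᵖ (b , b↭) = a ⊕ˡ b , subst (a ⊕ˡ b ↭_) ascending-length (⊕ˡ-↭ a↭ b↭)
  where
  ascending-length : ascending (length a) ⊕ˡ ascending (length b) ≡ ascending (length (a ⊕ˡ b))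
  ascending-length =
    trans (ascending-⊕ˡ (length a) (length b)) (cong ascending (sym (length-⊕ˡ a b)))

ε : Perm
ε = [] , ↭-refl

[]-≼ : (p : IsPerm []) (β : Perm) → ([] , p) ≼ β
[]-≼ p β = [] , minimum _ , refl , λ ()

≼-refl : (γ : Perm) → γ ≼ γ
≼-refl γ = proj₁ γ , ⊆-refl , OrderIso-refl (proj₁ γ)

≼⇒length-≤ : {α β : Perm} → α ≼ β → length (proj₁ α) ≤ length (proj₁ β)
≼⇒length-≤ (s , s⊆β , |α|≡|s| , _) = ≤-trans (≤-reflexive |α|≡|s|) (length-mono-≤ s⊆β)

_^_ : Perm → ℕ → Perm
σ ^ zero  = ε
σ ^ suc k = (σ ^ k) ⊕ᵖ σ

length-^ : (σ : Perm) (k : ℕ) → length (proj₁ (σ ^ k)) ≡ k * length (proj₁ σ)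
length-^ σ zero    = refl
length-^ σ (suc k) = begin
  length (proj₁ (σ ^ k) ⊕ˡ proj₁ σ)         ≡⟨ length-⊕ˡ (proj₁ (σ ^ k)) (proj₁ σ) ⟩
  length (proj₁ (σ ^ k)) + length (proj₁ σ) ≡⟨ cong (_+ length (proj₁ σ)) (length-^ σ k) ⟩
  k * length (proj₁ σ) + length (proj₁ σ)   ≡⟨ +-comm (k * length (proj₁ σ)) _ ⟩
  suc k * length (proj₁ σ)                  ∎
  where open ≡-Reasoning

^-closed : {S : PermSet} → Closed S → SumComplete S → (σ : Perm) → S σ → (k : ℕ) → S (σ ^ k)
^-closed cl sc σ σ∈S zero    = cl ε σ ([]-≼ ↭-refl σ) σ∈S
^-closed cl sc σ σ∈S (suc k) = sc (σ ^ k) σ (^-closed cl sc σ σ∈S k) σ∈S _ refl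

lastSummand-≼ : (γ σ ρ τ : Perm) (k : ℕ) →
  proj₁ (γ ⊕ᵖ (σ ^ suc k)) ≡ proj₁ ρ ⊕ˡ proj₁ τ → length (proj₁ ρ) ≤ k → σ ≼ τ
lastSummand-≼ γ ([] , p) ρ τ k _ _ = []-≼ p τ
lastSummand-≼ (g , _) σ@(x ∷ s , _) (r , _) (t , _) k g⊕σᵏ⁺¹≡r⊕t |r|≤k =
  ⊕ˡ-rightSummand-embeds (trans (⊕ˡ-assoc g q (x ∷ s)) g⊕σᵏ⁺¹≡r⊕t) |r|≤|g⊕q|
  where
  q = proj₁ (σ ^ k)
  |r|≤|g⊕q| : length r ≤ length (g ⊕ˡ q)
  |r|≤|g⊕q| = begin
    length r                 ≤⟨ |r|≤k ⟩
    k                        ≤⟨ m≤m*n k (suc (length s)) ⟩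
    k * suc (length s)       ≡⟨ length-^ σ k ⟨
    length q                 ≤⟨ m≤n+m (length q) (length g) ⟩
    length g + length q      ≡⟨ length-⊕ˡ g q ⟨
    length (g ⊕ˡ q)          ∎
    where open ≤-Reasoning

summand-⊆ : (γ₁ γ₂ : Perm) {S₁ S₂ : PermSet} → Closed S₁ → SumComplete S₁ → Closed S₂ →
  (∀ π → (Sub γ₁ ⊕ S₁) π → (Sub γ₂ ⊕ S₂) π) → ∀ σ → S₁ σ → S₂ σ
summand-⊆ γ₁ γ₂ {S₂ = S₂} cl₁ sc₁ cl₂ ⊕-⊆ σ σ∈S₁ =
  σ∈S₂ (⊕-⊆ π (γ₁ , σ ^ suc k , ≼-refl γ₁ , ^-closed cl₁ sc₁ σ σ∈S₁ (suc k) , refl))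
  where
  k = length (proj₁ γ₂)
  π = γ₁ ⊕ᵖ (σ ^ suc k)
  σ∈S₂ : (Sub γ₂ ⊕ S₂) π → S₂ σ
  σ∈S₂ (ρ , τ , ρ≼γ₂ , τ∈S₂ , π≡ρ⊕τ) =
    cl₂ σ τ (lastSummand-≼ γ₁ σ ρ τ k π≡ρ⊕τ (≼⇒length-≤ {ρ} {γ₂} ρ≼γ₂)) τ∈S₂

proposition2 : (X : PermSet) (γ₁ γ₂ : Perm) (S₁ S₂ : PermSet) →
    Closed S₁ → SumComplete S₁ → Closed S₂ → SumComplete S₂ →
    X ≐ (Sub γ₁ ⊕ S₁) → X ≐ (Sub γ₂ ⊕ S₂) →
    S₁ ≐ S₂
proposition2 X γ₁ γ₂ S₁ S₂ cl₁ sc₁ cl₂ sc₂ X≐₁ X≐₂ σ =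
  summand-⊆ γ₁ γ₂ cl₁ sc₁ cl₂ (λ π → proj₁ (X≐₂ π) ∘ proj₂ (X≐₁ π)) σ ,
  summand-⊆ γ₂ γ₁ cl₂ sc₂ cl₁ (λ π → proj₁ (X≐₁ π) ∘ proj₂ (X≐₂ π)) σ
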